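{- Let $P_0$ be an antichain with $m_0$ elements $x_1,\dots,x_{m_0}$, and let $m_1,\dots,m_{m_0}$ be nonnegative integers. Then $$L_+(P_0;m_1,\dots,m_{m_0})=\Big(\sum_{i=1}^{m_0}m_i\Big)!\Big/\prod_{i=1}^{m_0}m_i!.$$ Moreover: (i) if at most one of $m_1,\dots,m_{m_0}$ is odd, then $$L_-(P_0;m_1,\dots,m_{m_0})=\Big(\sum_{i=1}^{m_0}\lfloor m_i/2\rfloor\Big)!\Big/\prod_{i=1}^{m_0}\lfloor m_i/2\rfloor!;$$ (ii) if more than one of $m_1,\dots,m_{m_0}$ is odd, then $L_-(P_0;m_1,\dots,m_{m_0})=0$.
   Context: For a finite poset $P_0=(|P_0|,\preccurlyeq_0)$ with $|P_0|=\{x_1,\dots,x_{m_0}\}$ and nonnegative integers $m_1,\dots,m_{m_0}$, let $P_0*(C_1,\dots,C_{m_0})$ be the poset on $\{x_{i,j}:1\leq i\leq m_0,1\leq j\leq m_i\}$ with $x_{i,j}\preccurlyeq x_{i',j'}$ iff either ($i\neq i'$ and $x_i\preccurlyeq_0 x_{i'}$) or ($i=i'$ and $j\leq j'$). Its reference order is the lexicographic order on $(i,j)$. A linearization (total order refining $\preccurlyeq$) is even/odd according as the permutation carrying the reference order to it is even/odd. $L_+(P_0;m_1,\dots,m_{m_0})$ is the number of linearizations of $P_0*(C_1,\dots,C_{m_0})$ and $L_-(P_0;m_1,\dots,m_{m_0})$ is the number of even linearizations minus the number of odd ones. -}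

module Defs where

open import Data.Bool using (Bool; true; false; not; _∧_; _∨_; if_then_else_)
open import Data.Nat using (ℕ; zero; suc; _+_; _*_; _!; ⌊_/2⌋; _%_; _≤ᵇ_; _<ᵇ_; _≡ᵇ_)
open import Data.Fin using (Fin; toℕ)
open import Data.Integer using (ℤ; +_; -_)
open import Data.List using (List; []; _∷_; map; concatMap; allFin; upTo; length; foldr)
open import Data.Nat.ListAction using (sum; product)
open import Data.Product using (_×_; _,_)
open import Relation.Nullary.Decidable using (⌊_⌋)
open import Data.Fin using (_≟_)

-- An element x_{i,j} of P0 * (C_1,...,C_{m0}) is encoded as the pair (i , j)
-- with i : Fin m0 (0-based index of x_i) and j : ℕ with 0 ≤ j < m i (0-based).
Elt : ℕ → Set
Elt m0 = Fin m0 × ℕ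

elems : (m0 : ℕ) → (Fin m0 → ℕ) → List (Elt m0)
elems m0 m = concatMap (λ i → map (λ j → (i , j)) (upTo (m i))) (allFin m0)

total : (m0 : ℕ) → (Fin m0 → ℕ) → ℕ
total m0 m = sum (map m (allFin m0))

eqElt : ∀ {m0} → Elt m0 → Elt m0 → Bool
eqElt (i , j) (i' , j') = ⌊ i ≟ i' ⌋ ∧ (j ≡ᵇ j')

lexLt : ∀ {m0} → Elt m0 → Elt m0 → Bool
lexLt (i , j) (i' , j') = (toℕ i <ᵇ toℕ i') ∨ (⌊ i ≟ i' ⌋ ∧ (j <ᵇ j'))

-- The order of P0 * (C_1,...,C_{m0}), where the poset P0 on Fin m0 is given
-- by a Boolean relation R (R i i' = true iff x_i ≼₀ x_i').
starLeq : ∀ {m0} → (Fin m0 → Fin m0 → Bool) → Elt m0 → Elt m0 → Bool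
starLeq R (i , j) (i' , j') =
  (not ⌊ i ≟ i' ⌋ ∧ R i i') ∨ (⌊ i ≟ i' ⌋ ∧ (j ≤ᵇ j'))

antichain : (m0 : ℕ) → Fin m0 → Fin m0 → Bool
antichain m0 i i' = ⌊ i ≟ i' ⌋

allB : ∀ {A : Set} → (A → Bool) → List A → Bool
allB p []       = true
allB p (x ∷ xs) = p x ∧ allB p xs

filterB : ∀ {A : Set} → (A → Bool) → List A → List A
filterB p []       = []
filterB p (x ∷ xs) = if p x then x ∷ filterB p xs else filterB p xs

words : ∀ {A : Set} → ℕ → List A → List (List A)
words zero    xs = [] ∷ []
words (suc n) xs = concatMap (λ x → map (x ∷_) (words n xs)) xs

distinct : ∀ {m0} → List (Elt m0) → Bool
distinct []      = true
distinct (x ∷ w) = allB (λ y → not (eqElt x y)) w ∧ distinct w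

-- The order given by w refines ≼: no later element is ≼ an earlier one
-- (for distinct letters this is exactly: x ≼ y implies x is placed before y).
refines : ∀ {m0} → (Elt m0 → Elt m0 → Bool) → List (Elt m0) → Bool
refines leq []      = true
refines leq (x ∷ w) = allB (λ y → not (leq y x)) w ∧ refines leq w

-- Linearizations of P0 * (C_1,...,C_{m0}): words of length N over the N
-- elements with distinct letters (i.e. orderings of all elements) refining ≼.
linearizations : (m0 : ℕ) → (Fin m0 → Fin m0 → Bool) → (Fin m0 → ℕ) → List (List (Elt m0))
linearizations m0 R m =
  filterB (λ w → distinct w ∧ refines (starLeq R) w)
         (words (total m0 m) (elems m0 m))

-- This is the
-- inversion number of the permutation carrying the reference order to w.
inversions : ∀ {m0} → List (Elt m0) → ℕ
inversions []      = 0
inversions (x ∷ w) = length (filterB (λ y → lexLt y x) w) + inversions w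

sign : ∀ {m0} → List (Elt m0) → ℤ
sign w = if (inversions w % 2) ≡ᵇ 0 then + 1 else - (+ 1)

Lplus : (m0 : ℕ) → (Fin m0 → Fin m0 → Bool) → (Fin m0 → ℕ) → ℕ
Lplus m0 R m = length (linearizations m0 R m)

Lminus : (m0 : ℕ) → (Fin m0 → Fin m0 → Bool) → (Fin m0 → ℕ) → ℤ
Lminus m0 R m = foldr Data.Integer._+_ (+ 0) (map sign (linearizations m0 R m))
  where import Data.Integer

oddCount : (m0 : ℕ) → (Fin m0 → ℕ) → ℕ
oddCount m0 m = length (filterB (λ i → (m i % 2) ≡ᵇ 1) (allFin m0))

module Submission where

open import Defs
open import Data.Nat using (ℕ; _*_; _!; ⌊_/2⌋; _≤_; _≥_)
open import Data.Fin using (Fin)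
open import Data.List using (map; allFin)
open import Data.Nat.ListAction using (sum; product)
open import Data.Integer using (ℤ; +_) renaming (_*_ to _ℤ*_)
open import Data.Product using (_×_)
open import Relation.Binary.PropositionalEquality using (_≡_)

-- For an antichain P0 the poset
-- P0 * (C_1,…,C_m0) is a disjoint union of chains, so its linearizations are
-- the shuffles of the chains.  We describe them through their first letter.
-- A state a records how many elements of each chain are already placed; a
-- partial linearization from a ('Lin n (avail a)') must start with the next
-- element (i , a i) of some chain ('Antichain.Lin-step').  This yields
-- recursions over states for the number of partial linearizations
-- ('Counting.count-step') and for their signed number, where placing (i , a i)
-- first creates one inversion with every remaining letter of a chain of
-- smaller index ('Signs.signed-step').  Induction on the number of remaining
-- letters solves both: the count is the multinomial coefficient of the
-- remaining chain lengths ('Counting.count-multinomial'), and the signed count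
-- is [at most one odd length] times the multinomial coefficient of the halved
-- lengths ('SignedMultinomial', 'SignedCount.signed-closed-form').  The
-- theorem is the specialisation to the initial state.

open import Algebra.Bundles using (CommutativeMonoid)
open import Data.Bool using (Bool; true; false; not; _∧_; _∨_; if_then_else_; T)
open import Data.Bool.Properties using (T-∧)
open import Data.Fin using (toℕ; zero; suc; _≟_)
open import Data.Integer using (-_) renaming (_+_ to _ℤ+_)
import Data.Integer.Properties as ℤP
open import Data.List using (List; []; _∷_; _++_; concatMap; tabulate; upTo; length; foldr)
open import Data.List.Relation.Unary.All using (All; []; _∷_)
import Data.List.Relation.Unary.All as All
import Data.List.Relation.Unary.All.Properties as All
open import Data.Nat using (zero; suc; NonZero; _+_; _∸_; pred; _<_; _%_; _≤ᵇ_; _<ᵇ_; _≡ᵇ_; z≤n; s≤s)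
open import Data.Nat.Properties as ℕP using (_≤?_; _<?_)
open import Data.Product using (_,_; proj₁; proj₂)
open import Data.Vec.Functional using (Vector; updateAt)
open import Data.Vec.Functional.Properties using (updateAt-updates; updateAt-minimal)
open import Function using (_∘_)
open import Function.Bundles using (Equivalence)
open import Relation.Binary.PropositionalEquality using (refl; sym; trans; cong; cong₂; subst; _≢_; module ≡-Reasoning)
open import Relation.Nullary using (yes; no; ¬_; contradiction)
open import Relation.Nullary.Decidable using (dec-true; dec-false)

module FiniteSums {c ℓ} (M : CommutativeMonoid c ℓ) where
  open CommutativeMonoid M renaming (refl to ≈-refl; sym to ≈-sym; trans to ≈-trans)
  open import Algebra.Properties.CommutativeMonoid.Sum M public
    using (sum-cong-≗) renaming (sum to ∑)
  open import Algebra.Properties.CommutativeMonoid.Sum M using (sum-replicate-zero)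
  open import Relation.Binary.Reasoning.Setoid setoid

  ∑-vanish : ∀ {k} (f : Vector Carrier k) → (∀ i → f i ≡ ε) → ∑ f ≈ ε
  ∑-vanish {k} f f≡ε = ≈-trans (reflexive (sum-cong-≗ f≡ε)) (sum-replicate-zero k)

  without : ∀ {k} → Vector Carrier k → Fin k → Vector Carrier k
  without f i = updateAt f i (λ _ → ε)

  sum-pick : ∀ {k} (f : Vector Carrier k) i → ∑ f ≈ f i ∙ ∑ (without f i)
  sum-pick f zero    = ∙-congˡ (≈-sym (identityˡ _))
  sum-pick f (suc i) = begin
    f zero ∙ ∑ (f ∘ suc)                                 ≈⟨ ∙-congˡ (sum-pick (f ∘ suc) i) ⟩
    f zero ∙ (f (suc i) ∙ ∑ (without (f ∘ suc) i))       ≈⟨ ≈-sym (assoc _ _ _) ⟩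
    (f zero ∙ f (suc i)) ∙ ∑ (without (f ∘ suc) i)       ≈⟨ ∙-congʳ (comm _ _) ⟩
    (f (suc i) ∙ f zero) ∙ ∑ (without (f ∘ suc) i)       ≈⟨ assoc _ _ _ ⟩
    f (suc i) ∙ (f zero ∙ ∑ (without (f ∘ suc) i))       ∎

  without-agree : ∀ {k} (f g : Vector Carrier k) i → (∀ j → j ≢ i → f j ≡ g j) →
                  ∀ j → without f i j ≡ without g i j
  without-agree f g i agree j with j ≟ i
  ... | yes refl = trans (updateAt-updates i f) (sym (updateAt-updates i g))
  ... | no  j≢i  = trans (updateAt-minimal j i f j≢i)
                     (trans (agree j j≢i) (sym (updateAt-minimal j i g j≢i)))

  sum-step : ∀ {k} (f g : Vector Carrier k) i d → (∀ j → j ≢ i → f j ≡ g j) →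
             f i ≈ d ∙ g i → ∑ f ≈ d ∙ ∑ g
  sum-step f g i d agree fi≈ = begin
    ∑ f                            ≈⟨ sum-pick f i ⟩
    f i ∙ ∑ (without f i)          ≈⟨ ∙-cong fi≈ (reflexive (sum-cong-≗ (without-agree f g i agree))) ⟩
    (d ∙ g i) ∙ ∑ (without g i)    ≈⟨ assoc _ _ _ ⟩
    d ∙ (g i ∙ ∑ (without g i))    ≈⟨ ∙-congˡ (≈-sym (sum-pick g i)) ⟩
    d ∙ ∑ g                        ∎

  foldr-tabulate : ∀ {A : Set} {k} (f : A → Carrier) (g : Fin k → A) →
                   foldr _∙_ ε (map f (tabulate g)) ≈ ∑ (f ∘ g)
  foldr-tabulate {k = zero}  f g = ≈-refl
  foldr-tabulate {k = suc k} f g = ∙-congˡ (foldr-tabulate f (g ∘ suc))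

  module _ {B : Set} (h : List B → Carrier) (h-[] : h [] ≈ ε)
           (h-++ : ∀ xs ys → h (xs ++ ys) ≈ h xs ∙ h ys) where
    concatMap-tabulate : ∀ {A : Set} {k} (f : A → List B) (g : Fin k → A) →
                         h (concatMap f (tabulate g)) ≈ ∑ (h ∘ f ∘ g)
    concatMap-tabulate {k = zero}  f g = h-[]
    concatMap-tabulate {k = suc k} f g =
      ≈-trans (h-++ (f (g zero)) _) (∙-congˡ (concatMap-tabulate f (g ∘ suc)))

module Σℕ = FiniteSums ℕP.+-0-commutativeMonoid
module Σℤ = FiniteSums ℤP.+-0-commutativeMonoid
module Πℕ = FiniteSums ℕP.*-1-commutativeMonoid

∏ : ∀ {k} → (Fin k → ℕ) → ℕ
∏ = Πℕ.∑

∏!-nonZero : ∀ {k} (f : Fin k → ℕ) → NonZero (∏ (λ i → f i !))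
∏!-nonZero {zero}  f = _
∏!-nonZero {suc k} f = ℕP.m*n≢0 (f zero !) _ {{f zero ℕP.!≢0}} {{∏!-nonZero (f ∘ suc)}}

∑ℕ≡0 : ∀ {k} (f : Fin k → ℕ) → Σℕ.∑ f ≡ 0 → ∀ i → f i ≡ 0
∑ℕ≡0 f ∑≡0 zero    = ℕP.m+n≡0⇒m≡0 (f zero) ∑≡0
∑ℕ≡0 f ∑≡0 (suc i) = ∑ℕ≡0 (f ∘ suc) (ℕP.m+n≡0⇒n≡0 (f zero) ∑≡0) i

module Comparisons where
  ≤ᵇ-true : ∀ {m n} → m ≤ n → (m ≤ᵇ n) ≡ true
  ≤ᵇ-true = dec-true (_ ≤? _)

  ≤ᵇ-false : ∀ {m n} → ¬ m ≤ n → (m ≤ᵇ n) ≡ false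
  ≤ᵇ-false = dec-false (_ ≤? _)

  <ᵇ-true : ∀ {m n} → m < n → (m <ᵇ n) ≡ true
  <ᵇ-true = dec-true (_ <? _)

  <ᵇ-false : ∀ {m n} → ¬ m < n → (m <ᵇ n) ≡ false
  <ᵇ-false = dec-false (_ <? _)

  ≡ᵇ-true : ∀ {m n} → m ≡ n → (m ≡ᵇ n) ≡ true
  ≡ᵇ-true = dec-true (_ ℕP.≟ _)

  ≡ᵇ-false : ∀ {m n} → m ≢ n → (m ≡ᵇ n) ≡ false
  ≡ᵇ-false = dec-false (_ ℕP.≟ _)

module ConcatMaps where
  open import Data.List.Properties using (concatMap-++; ++-identityʳ; upTo-∷ʳ)
  open Comparisons

  concatMap-All-[] : ∀ {A B : Set} {f : A → List B} {xs} →
                     All (λ x → f x ≡ []) xs → concatMap f xs ≡ []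
  concatMap-All-[] []             = refl
  concatMap-All-[] (fx≡[] ∷ eqs) rewrite fx≡[] = concatMap-All-[] eqs

  concatMap-concatMap : ∀ {A B C : Set} (f : B → List C) (g : A → List B) xs →
                        concatMap f (concatMap g xs) ≡ concatMap (concatMap f ∘ g) xs
  concatMap-concatMap f g []       = refl
  concatMap-concatMap f g (x ∷ xs) =
    trans (concatMap-++ f (g x) (concatMap g xs)) (cong (concatMap f (g x) ++_) (concatMap-concatMap f g xs))

  concatMap-upTo-single : ∀ {B : Set} k c (G : List B) (f : ℕ → List B) →
    (∀ j → j < k → f j ≡ (if j ≡ᵇ c then G else [])) →
    concatMap f (upTo k) ≡ (if c <ᵇ k then G else [])
  concatMap-upTo-single zero    c G f only-c = refl
  concatMap-upTo-single (suc k) c G f only-c = begin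
    concatMap f (upTo (suc k))
      ≡⟨ cong (concatMap f) (sym (upTo-∷ʳ k)) ⟩
    concatMap f (upTo k ++ k ∷ [])
      ≡⟨ concatMap-++ f (upTo k) (k ∷ []) ⟩
    concatMap f (upTo k) ++ f k ++ []
      ≡⟨ cong₂ (λ xs ys → xs ++ ys ++ [])
               (concatMap-upTo-single k c G f (λ j j<k → only-c j (ℕP.m<n⇒m<1+n j<k))) (only-c k ℕP.≤-refl) ⟩
    (if c <ᵇ k then G else []) ++ (if k ≡ᵇ c then G else []) ++ []
      ≡⟨ last-step (ℕP.<-cmp c k) ⟩
    (if c <ᵇ suc k then G else [])
      ∎
    where
    open ≡-Reasoning
    open import Relation.Binary using (Tri; tri<; tri≈; tri>)
    last-step : Tri (c < k) (c ≡ k) (k < c) →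
      (if c <ᵇ k then G else []) ++ (if k ≡ᵇ c then G else []) ++ [] ≡ (if c <ᵇ suc k then G else [])
    last-step (tri< c<k _ _)
      rewrite <ᵇ-true c<k | ≡ᵇ-false (ℕP.>⇒≢ c<k) | <ᵇ-true (ℕP.m<n⇒m<1+n c<k) = ++-identityʳ G
    last-step (tri≈ _ refl _)
      rewrite <ᵇ-false (ℕP.n≮n c) | ≡ᵇ-true (refl {x = c}) | <ᵇ-true (ℕP.n<1+n c) = ++-identityʳ G
    last-step (tri> _ _ k<c)
      rewrite <ᵇ-false (ℕP.<⇒≯ k<c) | ≡ᵇ-false (ℕP.<⇒≢ k<c) | <ᵇ-false (ℕP.≤⇒≯ k<c) = refl

module BoolLists where
  open import Data.Bool.Properties using (∧-commutativeMonoid)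
  open import Algebra.Solver.CommutativeMonoid ∧-commutativeMonoid using (solve; _⊜_; _⊕_)

  filterB-++ : ∀ {A : Set} (p : A → Bool) xs ys →
               filterB p (xs ++ ys) ≡ filterB p xs ++ filterB p ys
  filterB-++ p []       ys = refl
  filterB-++ p (x ∷ xs) ys with p x
  ... | true  = cong (x ∷_) (filterB-++ p xs ys)
  ... | false = filterB-++ p xs ys

  filterB-concatMap : ∀ {A B : Set} (p : B → Bool) (f : A → List B) xs →
                      filterB p (concatMap f xs) ≡ concatMap (filterB p ∘ f) xs
  filterB-concatMap p f []       = refl
  filterB-concatMap p f (x ∷ xs) =
    trans (filterB-++ p (f x) (concatMap f xs)) (cong (filterB p (f x) ++_) (filterB-concatMap p f xs))

  filterB-All-cong : ∀ {A : Set} {p q : A → Bool} {xs} → All (λ x → p x ≡ q x) xs →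
                     filterB p xs ≡ filterB q xs
  filterB-All-cong                  []             = refl
  filterB-All-cong {q = q} {x ∷ _} (px≡qx ∷ eqs) rewrite px≡qx with q x
  ... | true  = cong (x ∷_) (filterB-All-cong eqs)
  ... | false = filterB-All-cong eqs

  filterB-All : ∀ {A : Set} (p : A → Bool) xs → All (T ∘ p) (filterB p xs)
  filterB-All p []       = []
  filterB-All p (x ∷ xs) with p x in px≡
  ... | true  = subst T (sym px≡) _ ∷ filterB-All p xs
  ... | false = filterB-All p xs

  allB-All : ∀ {A : Set} (p : A → Bool) w → T (allB p w) → All (T ∘ p) w
  allB-All p []      _  = []
  allB-All p (y ∷ w) ok = proj₁ (split ok) ∷ allB-All p w (proj₂ (split ok))
    where
    split : T (p y ∧ allB p w) → T (p y) × T (allB p w)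
    split = Equivalence.to T-∧

  filterB-cons : ∀ {A : Set} (p q : List A → Bool) x b → (∀ w → p (x ∷ w) ≡ b ∧ q w) →
                 ∀ ws → filterB p (map (x ∷_) ws) ≡ (if b then map (x ∷_) (filterB q ws) else [])
  filterB-cons p q x false split []       = refl
  filterB-cons p q x true  split []       = refl
  filterB-cons p q x b     split (w ∷ ws) rewrite split w with b | q w | filterB-cons p q x b split ws
  ... | false | _     | ih = ih
  ... | true  | true  | ih = cong ((x ∷ w) ∷_) ih
  ... | true  | false | ih = ih

  allB-∧ : ∀ {A : Set} (p q : A → Bool) w → allB (λ y → p y ∧ q y) w ≡ allB p w ∧ allB q w
  allB-∧ p q []      = refl
  allB-∧ p q (y ∷ w) = trans (cong ((p y ∧ q y) ∧_) (allB-∧ p q w))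
    (solve 4 (λ a b c d → (a ⊕ b) ⊕ (c ⊕ d) ⊜ (a ⊕ c) ⊕ (b ⊕ d)) refl (p y) (q y) (allB p w) (allB q w))

  allB-cong : ∀ {A : Set} {p q : A → Bool} → (∀ x → p x ≡ q x) → ∀ w → allB p w ≡ allB q w
  allB-cong p≗q []      = refl
  allB-cong p≗q (y ∷ w) = cong₂ _∧_ (p≗q y) (allB-cong p≗q w)

∸-split : ∀ a j M → a ≤ j → j < M → M ∸ a ≡ suc (j ∸ a) + (M ∸ suc j)
∸-split zero    j       M       _         j<M       = sym (ℕP.m+[n∸m]≡n j<M)
∸-split (suc a) (suc j) (suc M) (s≤s a≤j) (s≤s j<M) = ∸-split a j M a≤j j<M

sgn : ℕ → ℤ
sgn n = if n % 2 ≡ᵇ 0 then + 1 else - (+ 1)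

sgn-suc : ∀ n → sgn (suc n) ≡ - sgn n
sgn-suc zero          = refl
sgn-suc (suc zero)    = refl
sgn-suc (suc (suc n)) = sgn-suc n

sgn-+ : ∀ m n → sgn (m + n) ≡ sgn m ℤ* sgn n
sgn-+ zero    n = sym (ℤP.*-identityˡ (sgn n))
sgn-+ (suc m) n = begin
  sgn (suc m + n)       ≡⟨ sgn-suc (m + n) ⟩
  - sgn (m + n)         ≡⟨ cong -_ (sgn-+ m n) ⟩
  - (sgn m ℤ* sgn n)    ≡⟨ ℤP.neg-distribˡ-* (sgn m) (sgn n) ⟩
  - sgn m ℤ* sgn n      ≡⟨ cong (_ℤ* sgn n) (sgn-suc m) ⟨
  sgn (suc m) ℤ* sgn n  ∎
  where open ≡-Reasoning

prefix : ∀ {k} → (Fin k → ℕ) → ℕ → ℕ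
prefix ρ t = Σℕ.∑ (λ i → if toℕ i <ᵇ t then ρ i else 0)

prefix-0 : ∀ {k} (ρ : Fin k → ℕ) → prefix ρ 0 ≡ 0
prefix-0 ρ = Σℕ.∑-vanish (λ i → if toℕ i <ᵇ 0 then ρ i else 0) (λ _ → refl)

data ParityStep (n : ℕ) : Set where
  from-even : n % 2 ≡ 0 → suc n % 2 ≡ 1 → ⌊ suc n /2⌋ ≡ ⌊ n /2⌋     → ParityStep n
  from-odd  : n % 2 ≡ 1 → suc n % 2 ≡ 0 → ⌊ suc n /2⌋ ≡ suc ⌊ n /2⌋ → ParityStep n

parityStep : ∀ n → ParityStep n
parityStep zero          = from-even refl refl refl
parityStep (suc zero)    = from-odd  refl refl refl
parityStep (suc (suc n)) with parityStep n
... | from-even n-even sn-odd  half≡ = from-even n-even sn-odd  (cong suc half≡)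
... | from-odd  n-odd  sn-even half≡ = from-odd  n-odd  sn-even (cong suc half≡)

sgn-even : ∀ {n} → n % 2 ≡ 0 → sgn n ≡ + 1
sgn-even n-even rewrite n-even = refl

even-no-half⇒0 : ∀ r → r % 2 ≡ 0 → ⌊ r /2⌋ ≡ 0 → r ≡ 0
even-no-half⇒0 zero          _  _  = refl
even-no-half⇒0 (suc zero)    () _
even-no-half⇒0 (suc (suc r)) _  ()

module PartialLinearizations {m0 : ℕ} (leq : Elt m0 → Elt m0 → Bool) (E : List (Elt m0)) where
  open BoolLists
  open import Data.List.Properties using (concatMap-cong)
  open import Data.Bool.Properties using (∧-commutativeMonoid)
  open import Algebra.Solver.CommutativeMonoid ∧-commutativeMonoid using (solve; _⊜_; _⊕_)

  admissible : (Elt m0 → Bool) → List (Elt m0) → Bool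
  admissible Q w = allB Q w ∧ (distinct w ∧ refines leq w)

  Lin : ℕ → (Elt m0 → Bool) → List (List (Elt m0))
  Lin n Q = filterB (admissible Q) (words n E)

  after : Elt m0 → (Elt m0 → Bool) → Elt m0 → Bool
  after x Q y = Q y ∧ (not (eqElt x y) ∧ not (leq y x))

  admissible-cons : ∀ Q x w → admissible Q (x ∷ w) ≡ Q x ∧ admissible (after x Q) w
  admissible-cons Q x w = trans
    (solve 6 (λ q a n d l r → (q ⊕ a) ⊕ ((n ⊕ d) ⊕ (l ⊕ r)) ⊜ q ⊕ ((a ⊕ (n ⊕ l)) ⊕ (d ⊕ r))) refl
       (Q x) (allB Q w) (allB notEq w) (distinct w) (allB notBelow w) (refines leq w))
    (cong (λ b → Q x ∧ (b ∧ (distinct w ∧ refines leq w)))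
       (sym (trans (allB-∧ Q _ w) (cong (allB Q w ∧_) (allB-∧ notEq notBelow w)))))
    where
    notEq notBelow : Elt m0 → Bool
    notEq y    = not (eqElt x y)
    notBelow y = not (leq y x)

  Lin-suc : ∀ n Q → Lin (suc n) Q ≡ concatMap (λ x → if Q x then map (x ∷_) (Lin n (after x Q)) else []) E
  Lin-suc n Q = trans (filterB-concatMap (admissible Q) (λ x → map (x ∷_) (words n E)) E)
    (concatMap-cong (λ x → filterB-cons (admissible Q) (admissible (after x Q)) x (Q x)
                              (admissible-cons Q x) (words n E)) E)

  Lin-cong : ∀ n {Q Q′ : Elt m0 → Bool} → (∀ y → Q y ≡ Q′ y) → Lin n Q ≡ Lin n Q′
  Lin-cong n Q≗Q′ = filterB-All-cong (All.universal (λ w → cong (_∧ _) (allB-cong Q≗Q′ w)) (words n E))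

  Lin-admissible : ∀ n Q → All (λ w → All (T ∘ Q) w) (Lin n Q)
  Lin-admissible n Q = All.map (λ {w} ok → allB-All Q w (proj₁ (Equivalence.to (T-∧ {allB Q w}) ok)))
                                (filterB-All (admissible Q) (words n E))

-- Since
-- distinct chains are incomparable, the admissible letters are described by a
-- state a : Fin m0 → ℕ, where a i elements of chain i have been placed and
-- exactly the letters (i , j) with a i ≤ j remain.
module Antichain (m0 : ℕ) (m : Fin m0 → ℕ) where
  open PartialLinearizations (starLeq (antichain m0)) (elems m0 m) public
  open Comparisons
  open ConcatMaps
  open import Data.List.Properties using (concatMap-map; concatMap-cong)
  open import Data.Bool.Properties using (∧-identityʳ; ∧-zeroʳ)
  open import Relation.Binary using (Tri; tri<; tri≈; tri>)

  State : Set
  State = Fin m0 → ℕ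

  avail : State → Elt m0 → Bool
  avail a (i , j) = a i ≤ᵇ j

  rem : State → Fin m0 → ℕ
  rem a i = m i ∸ a i

  size : State → ℕ
  size a = Σℕ.∑ (rem a)

  set : State → Fin m0 → ℕ → State
  set a i v = updateAt a i (λ _ → v)

  next : State → Fin m0 → State
  next a i = set a i (suc (a i))

  set-same : ∀ a i v → set a i v i ≡ v
  set-same a i v = updateAt-updates i a

  set-other : ∀ a i v {j} → j ≢ i → a j ≡ set a i v j
  set-other a i v j≢i = sym (updateAt-minimal _ i a j≢i)

  rem-set : ∀ a i v {j} → j ≢ i → rem a j ≡ rem (set a i v) j
  rem-set a i v {j} j≢i = cong (m j ∸_) (set-other a i v j≢i)

  after-avail : ∀ a i j → a i ≤ j → ∀ y → after (i , j) (avail a) y ≡ avail (set a i (suc j)) y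
  after-avail a i j ai≤j (i′ , j′) with i′ ≟ i | i ≟ i′
  ... | yes refl | yes _   rewrite set-same a i (suc j) = same-chain (ℕP.<-cmp j j′)
    where
    same-chain : Tri (j < j′) (j ≡ j′) (j′ < j) →
                 (a i ≤ᵇ j′) ∧ (not (j ≡ᵇ j′) ∧ not (j′ ≤ᵇ j)) ≡ (suc j ≤ᵇ j′)
    same-chain (tri< j<j′ _ _) rewrite ≤ᵇ-true (ℕP.≤-trans ai≤j (ℕP.<⇒≤ j<j′)) | ≡ᵇ-false (ℕP.<⇒≢ j<j′)
                                     | ≤ᵇ-false (ℕP.<⇒≱ j<j′) | ≤ᵇ-true j<j′ = refl
    same-chain (tri≈ _ refl _) rewrite ≡ᵇ-true (refl {x = j}) | ≤ᵇ-false (ℕP.n≮n j) = ∧-zeroʳ _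
    same-chain (tri> _ _ j′<j) rewrite ≡ᵇ-false (ℕP.>⇒≢ j′<j) | ≤ᵇ-true (ℕP.<⇒≤ j′<j)
                                     | ≤ᵇ-false (ℕP.<⇒≱ (ℕP.m<n⇒m<1+n j′<j)) = ∧-zeroʳ _
  ... | yes refl | no i≢i  = contradiction refl i≢i
  ... | no i′≢i  | yes i≡i′ = contradiction (sym i≡i′) i′≢i
  ... | no i′≢i  | no _    rewrite sym (set-other a i (suc j) i′≢i) = ∧-identityʳ _

  size-set : ∀ a i j → a i ≤ j → j < m i → size a ≡ suc (j ∸ a i) + size (set a i (suc j))
  size-set a i j ai≤j j<mi = Σℕ.sum-step (rem a) (rem (set a i (suc j))) i (suc (j ∸ a i))
    (λ _ → rem-set a i (suc j))
    (trans (∸-split (a i) j (m i) ai≤j j<mi) (cong (λ v → suc (j ∸ a i) + (m i ∸ v)) (sym (set-same a i (suc j)))))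

  All-elems : ∀ {P : Elt m0 → Set} → (∀ i j → j < m i → P (i , j)) → All P (elems m0 m)
  All-elems P-ij = All.concat⁺ (All.map⁺ (All.tabulate⁺ (λ i →
    All.map⁺ (All.applyUpTo⁺₁ (λ j → j) (m i) (P-ij i _)))))

  firstLetter : ℕ → State → Elt m0 → List (List (Elt m0))
  firstLetter n a x = if avail a x then map (x ∷_) (Lin n (after x (avail a))) else []

  firstLetter-avail : ∀ n a i j → a i ≤ j →
                      firstLetter n a (i , j) ≡ map ((i , j) ∷_) (Lin n (avail (set a i (suc j))))
  firstLetter-avail n a i j ai≤j rewrite ≤ᵇ-true ai≤j = cong (map _) (Lin-cong n (after-avail a i j ai≤j))

  Lin-empty : ∀ n a → size a < n → Lin n (avail a) ≡ []
  Lin-empty (suc n) a size<n = trans (Lin-suc n (avail a)) (concatMap-All-[] (All-elems vanish))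
    where
    vanish : ∀ i j → j < m i → firstLetter n a (i , j) ≡ []
    vanish i j j<mi with a i ≤? j
    ... | no  ai≰j rewrite ≤ᵇ-false ai≰j = refl
    ... | yes ai≤j = trans (firstLetter-avail n a i j ai≤j)
      (cong (map _) (Lin-empty n (set a i (suc j))
        (ℕP.≤-<-trans (ℕP.m≤n+m _ (j ∸ a i))
          (ℕP.≤-pred (subst (_< suc n) (size-set a i j ai≤j j<mi) size<n)))))

  branch : ℕ → State → Fin m0 → List (List (Elt m0))
  branch n a i = if a i <ᵇ m i then map ((i , a i) ∷_) (Lin n (avail (next a i))) else []

  -- With exactly n+1 letters left, a partial linearization must start with
  -- the next element of some chain: any other admissible first letter
  -- (i , j), j > a i, skips (i , a i), which can then no longer be placed.
  Lin-step : ∀ n a → size a ≡ suc n → Lin (suc n) (avail a) ≡ concatMap (branch n a) (allFin m0)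
  Lin-step n a size≡ = begin
    Lin (suc n) (avail a)
      ≡⟨ Lin-suc n (avail a) ⟩
    concatMap (firstLetter n a) (elems m0 m)
      ≡⟨ concatMap-concatMap (firstLetter n a) _ (allFin m0) ⟩
    concatMap (λ i → concatMap (firstLetter n a) (map (i ,_) (upTo (m i)))) (allFin m0)
      ≡⟨ concatMap-cong (λ i → trans (concatMap-map (firstLetter n a) (i ,_) (upTo (m i)))
                                  (concatMap-upTo-single (m i) (a i) _ _ (only-next i))) (allFin m0) ⟩
    concatMap (branch n a) (allFin m0)
      ∎
    where
    open ≡-Reasoning
    only-next : ∀ i j → j < m i → firstLetter n a (i , j) ≡
                (if j ≡ᵇ a i then map ((i , a i) ∷_) (Lin n (avail (next a i))) else [])
    only-next i j j<mi with ℕP.<-cmp j (a i)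
    ... | tri< j<ai _ _ rewrite ≤ᵇ-false (ℕP.<⇒≱ j<ai) | ≡ᵇ-false (ℕP.<⇒≢ j<ai) = refl
    ... | tri≈ _ refl _ rewrite ≡ᵇ-true (refl {x = a i}) = firstLetter-avail n a i (a i) ℕP.≤-refl
    ... | tri> _ _ ai<j rewrite ≡ᵇ-false (ℕP.>⇒≢ ai<j) =
      trans (firstLetter-avail n a i j (ℕP.<⇒≤ ai<j)) (cong (map _) (Lin-empty n (set a i (suc j)) fewer))
      where
      fewer : size (set a i (suc j)) < n
      fewer = subst (size (set a i (suc j)) <_)
                (ℕP.suc-injective (trans (sym (size-set a i j (ℕP.<⇒≤ ai<j) j<mi)) size≡))
                (ℕP.m<n+m _ (ℕP.m<n⇒0<n∸m ai<j))

  rem-next : ∀ a i → a i < m i → rem a i ≡ suc (rem (next a i) i)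
  rem-next a i ai<mi = trans (∸-split (a i) (a i) (m i) ℕP.≤-refl ai<mi)
    (cong₂ (λ d v → suc d + (m i ∸ v)) (ℕP.n∸n≡0 (a i)) (sym (set-same a i (suc (a i)))))

  size-next : ∀ a i → a i < m i → size a ≡ suc (size (next a i))
  size-next a i ai<mi = Σℕ.sum-step (rem a) (rem (next a i)) i 1 (λ _ → rem-set a i _) (rem-next a i ai<mi)

  size-next-pred : ∀ {n} a i → a i < m i → size a ≡ suc n → size (next a i) ≡ n
  size-next-pred a i ai<mi size≡ = ℕP.suc-injective (trans (sym (size-next a i ai<mi)) size≡)

  rem-exhausted : ∀ a → size a ≡ 0 → ∀ i → rem a i ≡ 0
  rem-exhausted a = ∑ℕ≡0 (rem a)

module Counting (m0 : ℕ) (m : Fin m0 → ℕ) where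
  open Antichain m0 m
  open Comparisons
  open import Data.List.Properties using (length-++; length-map)
  open import Algebra.Properties.CommutativeSemigroup ℕP.*-commutativeSemigroup using (x∙yz≈y∙xz)
  open import Algebra.Properties.Semiring.Sum ℕP.+-*-semiring using () renaming (*-distribʳ-sum to ∑ℕ-*ʳ)

  count : ℕ → State → ℕ
  count n a = length (Lin n (avail a))

  count-step : ∀ n a → size a ≡ suc n →
               count (suc n) a ≡ Σℕ.∑ (λ i → if a i <ᵇ m i then count n (next a i) else 0)
  count-step n a size≡ = trans (cong length (Lin-step n a size≡))
    (trans (Σℕ.concatMap-tabulate length refl (λ xs ys → length-++ xs) (branch n a) (λ i → i))
           (Σℕ.sum-cong-≗ length-branch))
    where
    length-branch : ∀ i → length (branch n a i) ≡ (if a i <ᵇ m i then count n (next a i) else 0)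
    length-branch i with a i <ᵇ m i
    ... | true  = length-map _ (Lin n (avail (next a i)))
    ... | false = refl

  ∏-next : ∀ a i → a i < m i → ∏ (λ k → rem a k !) ≡ rem a i * ∏ (λ k → rem (next a i) k !)
  ∏-next a i ai<mi = Πℕ.sum-step _ _ i (rem a i) (λ _ k≢i → cong _! (rem-set a i _ k≢i))
    (trans (cong _! rem≡) (cong (_* (rem (next a i) i !)) (sym rem≡)))
    where
    rem≡ : rem a i ≡ suc (rem (next a i) i)
    rem≡ = rem-next a i ai<mi

  count-multinomial : ∀ n a → size a ≡ n → count n a * ∏ (λ i → rem a i !) ≡ n !
  count-multinomial zero a size≡0 =
    trans (ℕP.*-identityˡ _) (Πℕ.∑-vanish _ (λ i → cong _! (rem-exhausted a size≡0 i)))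
  count-multinomial (suc n) a size≡ = begin
    count (suc n) a * P                                    ≡⟨ cong (_* P) (count-step n a size≡) ⟩
    Σℕ.∑ c * P                                             ≡⟨ ∑ℕ-*ʳ P c ⟩
    Σℕ.∑ (λ i → c i * P)                                   ≡⟨ Σℕ.sum-cong-≗ term ⟩
    Σℕ.∑ (λ i → rem a i * n !)                             ≡⟨ sym (∑ℕ-*ʳ (n !) (rem a)) ⟩
    size a * n !                                           ≡⟨ cong (_* n !) size≡ ⟩
    suc n !                                                ∎
    where
    open ≡-Reasoning
    P : ℕ
    P = ∏ (λ i → rem a i !)
    c : Fin m0 → ℕ
    c i = if a i <ᵇ m i then count n (next a i) else 0
    term : ∀ i → c i * P ≡ rem a i * n !
    term i with a i <? m i
    ... | no ai≮mi rewrite <ᵇ-false ai≮mi =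
      sym (cong (_* n !) (ℕP.m≤n⇒m∸n≡0 (ℕP.≮⇒≥ ai≮mi)))
    ... | yes ai<mi rewrite <ᵇ-true ai<mi = begin
      count n (next a i) * P        ≡⟨ cong (count n (next a i) *_) (∏-next a i ai<mi) ⟩
      count n (next a i) * (rem a i * P′) ≡⟨ x∙yz≈y∙xz (count n (next a i)) (rem a i) P′ ⟩
      rem a i * (count n (next a i) * P′) ≡⟨ cong (rem a i *_) (count-multinomial n (next a i) (size-next-pred a i ai<mi size≡)) ⟩
      rem a i * n !                 ∎
      where
      P′ : ℕ
      P′ = ∏ (λ k → rem (next a i) k !)

-- Placing the
-- next element of chain i first creates one inversion with each remaining
-- letter of a chain of smaller index; their number is tracked by the
-- invariant 'Balanced'.
module Signs (m0 : ℕ) (m : Fin m0 → ℕ) where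
  open Antichain m0 m
  open Comparisons
  open BoolLists using (filterB-All-cong)
  open import Data.Bool.Properties using (∨-identityʳ)

  below : ℕ → List (Elt m0) → ℕ
  below t w = length (filterB (λ y → toℕ (proj₁ y) <ᵇ t) w)

  Balanced : State → List (Elt m0) → Set
  Balanced a w = ∀ t → below t w ≡ prefix (rem a) t

  prefix-next : ∀ a i t → a i < m i →
                prefix (rem a) t ≡ (if toℕ i <ᵇ t then 1 else 0) + prefix (rem (next a i)) t
  prefix-next a i t ai<mi =
    Σℕ.sum-step _ _ i _ (λ k k≢i → cong (if toℕ k <ᵇ t then_else 0) (rem-set a i _ k≢i)) at-i
    where
    at-i : (if toℕ i <ᵇ t then rem a i else 0) ≡
           (if toℕ i <ᵇ t then 1 else 0) + (if toℕ i <ᵇ t then rem (next a i) i else 0)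
    at-i with toℕ i <ᵇ t
    ... | true  = rem-next a i ai<mi
    ... | false = refl

  Balanced-cons : ∀ a i w → a i < m i → Balanced (next a i) w → Balanced a ((i , a i) ∷ w)
  Balanced-cons a i w ai<mi bal t rewrite prefix-next a i t ai<mi | sym (bal t) with toℕ i <ᵇ t
  ... | true  = refl
  ... | false = refl

  balanced : ∀ n a → size a ≡ n → All (Balanced a) (Lin n (avail a))
  balanced zero    a size≡0 = (λ t → sym (Σℕ.∑-vanish _ (exhausted t))) ∷ []
    where
    exhausted : ∀ t i → (if toℕ i <ᵇ t then rem a i else 0) ≡ 0
    exhausted t i with toℕ i <ᵇ t
    ... | true  = rem-exhausted a size≡0 i
    ... | false = refl
  balanced (suc n) a size≡  =
    subst (All (Balanced a)) (sym (Lin-step n a size≡)) (All.concat⁺ (All.map⁺ (All.tabulate⁺ balanced-branch)))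
    where
    balanced-branch : ∀ i → All (Balanced a) (branch n a i)
    balanced-branch i with a i <? m i
    ... | no  ai≮mi rewrite <ᵇ-false ai≮mi = []
    ... | yes ai<mi rewrite <ᵇ-true ai<mi  = All.map⁺ (All.map (λ {w} → Balanced-cons a i w ai<mi)
        (balanced n (next a i) (size-next-pred a i ai<mi size≡)))

  lexLt-next : ∀ a i y → T (avail (next a i) y) → lexLt y (i , a i) ≡ (toℕ (proj₁ y) <ᵇ toℕ i)
  lexLt-next a i (i′ , j′) ok with i′ ≟ i
  ... | no  _    = ∨-identityʳ _
  ... | yes refl = trans (cong ((toℕ i <ᵇ toℕ i) ∨_) (<ᵇ-false (ℕP.<⇒≯ ai<j′))) (∨-identityʳ _)
    where
    ai<j′ : a i < j′
    ai<j′ = ℕP.≤ᵇ⇒≤ (suc (a i)) j′ (subst (λ v → T (v ≤ᵇ j′)) (set-same a i _) ok)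

  sign-cons : ∀ a i w → a i < m i → All (T ∘ avail (next a i)) w → Balanced (next a i) w →
              sign ((i , a i) ∷ w) ≡ sgn (prefix (rem a) (toℕ i)) ℤ* sign w
  sign-cons a i w ai<mi ok bal =
    trans (cong (λ k → sgn (k + inversions w)) inversions-first) (sgn-+ (prefix (rem a) (toℕ i)) (inversions w))
    where
    open ≡-Reasoning
    inversions-first : length (filterB (λ y → lexLt y (i , a i)) w) ≡ prefix (rem a) (toℕ i)
    inversions-first = begin
      length (filterB (λ y → lexLt y (i , a i)) w)  ≡⟨ cong length (filterB-All-cong (All.map (lexLt-next a i _) ok)) ⟩
      below (toℕ i) w                                ≡⟨ bal (toℕ i) ⟩
      prefix (rem (next a i)) (toℕ i)                ≡⟨ cong (λ b → (if b then 1 else 0) + prefix (rem (next a i)) (toℕ i))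
                                                              (<ᵇ-false (ℕP.n≮n (toℕ i))) ⟨
      (if toℕ i <ᵇ toℕ i then 1 else 0) + prefix (rem (next a i)) (toℕ i)
                                                     ≡⟨ prefix-next a i (toℕ i) ai<mi ⟨
      prefix (rem a) (toℕ i)                         ∎

  signSum : List (List (Elt m0)) → ℤ
  signSum L = foldr _ℤ+_ (+ 0) (map sign L)

  signSum-++ : ∀ xs ys → signSum (xs ++ ys) ≡ signSum xs ℤ+ signSum ys
  signSum-++ []       ys = sym (ℤP.+-identityˡ _)
  signSum-++ (x ∷ xs) ys =
    trans (cong (sign x ℤ+_) (signSum-++ xs ys)) (sym (ℤP.+-assoc (sign x) (signSum xs) (signSum ys)))

  signSum-cons : ∀ x c L → All (λ w → sign (x ∷ w) ≡ c ℤ* sign w) L →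
                 signSum (map (x ∷_) L) ≡ c ℤ* signSum L
  signSum-cons x c []      []       = sym (ℤP.*-zeroʳ c)
  signSum-cons x c (w ∷ L) (e ∷ es) = trans (cong₂ _ℤ+_ e (signSum-cons x c L es)) (sym (ℤP.*-distribˡ-+ c _ _))

  signed : ℕ → State → ℤ
  signed n a = signSum (Lin n (avail a))

  signed-step : ∀ n a → size a ≡ suc n → signed (suc n) a ≡
    Σℤ.∑ (λ i → if a i <ᵇ m i then sgn (prefix (rem a) (toℕ i)) ℤ* signed n (next a i) else + 0)
  signed-step n a size≡ = trans (cong signSum (Lin-step n a size≡))
    (trans (Σℤ.concatMap-tabulate signSum refl signSum-++ (branch n a) (λ i → i)) (Σℤ.sum-cong-≗ signed-branch))
    where
    signed-branch : ∀ i → signSum (branch n a i) ≡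
      (if a i <ᵇ m i then sgn (prefix (rem a) (toℕ i)) ℤ* signed n (next a i) else + 0)
    signed-branch i with a i <? m i
    ... | no  ai≮mi rewrite <ᵇ-false ai≮mi = refl
    ... | yes ai<mi rewrite <ᵇ-true ai<mi  =
      signSum-cons (i , a i) (sgn (prefix (rem a) (toℕ i))) (Lin n (avail (next a i)))
      (All.zipWith (λ { {w} (ok , bal) → sign-cons a i w ai<mi ok bal })
        (Lin-admissible n (avail (next a i)) , balanced n (next a i) (size-next-pred a i ai<mi size≡)))

-- The closed form of the signed count, in terms of the vector ρ of chain
-- lengths: with o odd entries, half-lengths h_i = ⌊ρ_i/2⌋ and H = Σ h_i,
--   (signed count) * Π h_i! = [o ≤ 1] * H!.
-- It is established by checking that the right-hand side satisfies the
-- recursion of 'Signs.signed-step'.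
module SignedMultinomial where
  open import Algebra.Properties.Semiring.Sum ℤP.+-*-semiring using (∑-distrib-+; *-distribʳ-sum; *-distribˡ-sum)
  open import Data.Integer.Solver using (module +-*-Solver)
  open +-*-Solver using (solve; _:+_; _:*_; _:=_)
  open import Algebra.Properties.CommutativeSemigroup ℤP.*-commutativeSemigroup using (x∙yz≈y∙xz)

  odd half halfFact : ∀ {k} → (Fin k → ℕ) → ℕ
  odd      ρ = Σℕ.∑ (λ i → ρ i % 2)
  half     ρ = Σℕ.∑ (λ i → ⌊ ρ i /2⌋)
  halfFact ρ = ∏ (λ i → ⌊ ρ i /2⌋ !)

  χ : ℕ → ℤ
  χ o = if o ≤ᵇ 1 then + 1 else + 0

  target : ∀ {k} → (Fin k → ℕ) → ℤ
  target ρ = χ (odd ρ) ℤ* + (half ρ !)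

  sgn-prefix-even : ∀ {k} (ρ : Fin k → ℕ) → odd ρ ≡ 0 → ∀ t → sgn (prefix ρ t) ≡ + 1
  sgn-prefix-even {zero}  ρ _      t       = refl
  sgn-prefix-even {suc k} ρ _      zero    = cong sgn (prefix-0 ρ)
  sgn-prefix-even {suc k} ρ odd≡0 (suc t) = begin
    sgn (ρ zero + prefix (ρ ∘ suc) t)           ≡⟨ sgn-+ (ρ zero) (prefix (ρ ∘ suc) t) ⟩
    sgn (ρ zero) ℤ* sgn (prefix (ρ ∘ suc) t)    ≡⟨ cong₂ _ℤ*_ (sgn-even {ρ zero} (ℕP.m+n≡0⇒m≡0 (ρ zero % 2) odd≡0))
                                                  (sgn-prefix-even (ρ ∘ suc) (ℕP.m+n≡0⇒n≡0 (ρ zero % 2) odd≡0) t) ⟩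
    + 1                                         ∎
    where open ≡-Reasoning

  sgn-prefix-odd : ∀ {k} (ρ : Fin k → ℕ) →
                   Σℤ.∑ (λ i → + (ρ i % 2) ℤ* sgn (prefix ρ (toℕ i))) ≡ + (odd ρ % 2)
  sgn-prefix-odd {zero}  ρ = refl
  sgn-prefix-odd {suc k} ρ = begin
    + (ρ zero % 2) ℤ* sgn (prefix ρ 0) ℤ+ Σℤ.∑ (λ i → x i ℤ* sgn (ρ zero + prefix (ρ ∘ suc) (toℕ i)))
      ≡⟨ cong₂ _ℤ+_ (cong (λ p → + (ρ zero % 2) ℤ* sgn p) (prefix-0 ρ)) (Σℤ.sum-cong-≗ pull-first) ⟩
    + (ρ zero % 2) ℤ* + 1 ℤ+ Σℤ.∑ (λ i → sgn (ρ zero) ℤ* (x i ℤ* s i))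
      ≡⟨ cong₂ _ℤ+_ (ℤP.*-identityʳ (+ (ρ zero % 2))) (sym (*-distribˡ-sum (sgn (ρ zero)) (λ i → x i ℤ* s i))) ⟩
    + (ρ zero % 2) ℤ+ sgn (ρ zero) ℤ* Σℤ.∑ (λ i → x i ℤ* s i)
      ≡⟨ cong (λ v → + (ρ zero % 2) ℤ+ sgn (ρ zero) ℤ* v) (sgn-prefix-odd (ρ ∘ suc)) ⟩
    + (ρ zero % 2) ℤ+ sgn (ρ zero) ℤ* + (odd (ρ ∘ suc) % 2)
      ≡⟨ parity-+ (ρ zero) (odd (ρ ∘ suc)) ⟩
    + ((ρ zero % 2 + odd (ρ ∘ suc)) % 2)        ∎
    where
    open ≡-Reasoning
    x s : Fin k → ℤ
    x i = + (ρ (suc i) % 2)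
    s i = sgn (prefix (ρ ∘ suc) (toℕ i))
    pull-first : ∀ i → x i ℤ* sgn (ρ zero + prefix (ρ ∘ suc) (toℕ i)) ≡ sgn (ρ zero) ℤ* (x i ℤ* s i)
    pull-first i = trans (cong (x i ℤ*_) (sgn-+ (ρ zero) (prefix (ρ ∘ suc) (toℕ i))))
                         (x∙yz≈y∙xz (x i) (sgn (ρ zero)) (s i))
    parity-+ : ∀ r o → + (r % 2) ℤ+ sgn r ℤ* + (o % 2) ≡ + ((r % 2 + o) % 2)
    parity-+ r o with parityStep r | parityStep o
    ... | from-even r-even _ _ | _ rewrite r-even = trans (ℤP.+-identityˡ _) (ℤP.*-identityˡ _)
    ... | from-odd  r-odd  _ _ | from-even o-even so-odd  _ rewrite r-odd | o-even | so-odd  = refl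
    ... | from-odd  r-odd  _ _ | from-odd  o-odd  so-even _ rewrite r-odd | o-odd  | so-even = refl

  -- The contributions of an odd and of an even entry to the recursion.
  oddPart evenPart : ∀ {k} → (Fin k → ℕ) → ℤ
  oddPart  ρ = χ (pred (odd ρ)) ℤ* + (half ρ !)
  evenPart ρ = χ (suc (odd ρ)) ℤ* + (pred (half ρ) !)

  contribution : ∀ {k} → (Fin k → ℕ) → Fin k → ℤ
  contribution ρ i = + (ρ i % 2) ℤ* oddPart ρ ℤ+ + ⌊ ρ i /2⌋ ℤ* evenPart ρ

  contribution-lower : ∀ {k} (ρ ρ′ : Fin k → ℕ) i → (∀ j → j ≢ i → ρ j ≡ ρ′ j) → ρ i ≡ suc (ρ′ i) →
                       ∀ D → D ℤ* + halfFact ρ′ ≡ target ρ′ → D ℤ* + halfFact ρ ≡ contribution ρ i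
  contribution-lower ρ ρ′ i agree ρi≡ D closed with parityStep (ρ′ i)
  ... | from-even ρ′i-even ρi-odd half≡ = begin
    D ℤ* + halfFact ρ                               ≡⟨ cong (λ p → D ℤ* + p) halfFact≡ ⟩
    D ℤ* + halfFact ρ′                              ≡⟨ closed ⟩
    χ (odd ρ′) ℤ* + (half ρ′ !)                     ≡⟨ cong₂ (λ o h → χ (pred o) ℤ* + (h !)) (sym odd≡) (sym halfSum≡) ⟩
    oddPart ρ                                       ≡⟨ ℤP.*-identityˡ (oddPart ρ) ⟨
    + 1 ℤ* oddPart ρ                                ≡⟨ ℤP.+-identityʳ _ ⟨
    + 1 ℤ* oddPart ρ ℤ+ + 0                         ≡⟨ cong₂ (λ b e → + b ℤ* oddPart ρ ℤ+ e) (sym ρi%2≡1) (sym no-even) ⟩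
    contribution ρ i                                ∎
    where
    open ≡-Reasoning
    ρi%2≡1 : ρ i % 2 ≡ 1
    ρi%2≡1 = trans (cong (_% 2) ρi≡) ρi-odd
    odd≡ : odd ρ ≡ suc (odd ρ′)
    odd≡ = Σℕ.sum-step _ _ i 1 (λ j j≢i → cong (_% 2) (agree j j≢i)) (trans ρi%2≡1 (cong suc (sym ρ′i-even)))
    halfSum≡ : half ρ ≡ half ρ′
    halfSum≡ = Σℕ.sum-step _ _ i 0 (λ j j≢i → cong ⌊_/2⌋ (agree j j≢i)) (trans (cong ⌊_/2⌋ ρi≡) half≡)
    halfFact≡ : halfFact ρ ≡ halfFact ρ′
    halfFact≡ = trans (Πℕ.sum-step _ _ i 1 (λ j j≢i → cong (λ r → ⌊ r /2⌋ !) (agree j j≢i))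
                         (trans (cong (λ r → ⌊ r /2⌋ !) ρi≡) (trans (cong _! half≡) (sym (ℕP.*-identityˡ _)))))
                      (ℕP.*-identityˡ _)
    no-even : + ⌊ ρ i /2⌋ ℤ* evenPart ρ ≡ + 0
    no-even = trans (cong (λ o → + ⌊ ρ i /2⌋ ℤ* (χ (suc o) ℤ* + (pred (half ρ) !))) odd≡)
                    (ℤP.*-zeroʳ (+ ⌊ ρ i /2⌋))
  ... | from-odd ρ′i-odd ρi-even half≡ = begin
    D ℤ* + halfFact ρ                               ≡⟨ cong (λ p → D ℤ* + p) halfFact≡ ⟩
    D ℤ* + (h * halfFact ρ′)                        ≡⟨ cong (D ℤ*_) (ℤP.pos-* h (halfFact ρ′)) ⟩
    D ℤ* (+ h ℤ* + halfFact ρ′)                     ≡⟨ x∙yz≈y∙xz D (+ h) (+ halfFact ρ′) ⟩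
    + h ℤ* (D ℤ* + halfFact ρ′)                     ≡⟨ cong (+ h ℤ*_) closed ⟩
    + h ℤ* (χ (odd ρ′) ℤ* + (half ρ′ !))            ≡⟨ cong₂ (λ o H → + h ℤ* (χ o ℤ* + (H !))) odd≡ (cong pred (sym halfSum≡)) ⟩
    + h ℤ* evenPart ρ                               ≡⟨ ℤP.+-identityˡ _ ⟨
    + 0 ℤ+ + h ℤ* evenPart ρ                        ≡⟨ cong (λ b → + b ℤ* oddPart ρ ℤ+ + h ℤ* evenPart ρ) (sym ρi%2≡0) ⟩
    contribution ρ i                                ∎
    where
    open ≡-Reasoning
    h : ℕ
    h = ⌊ ρ i /2⌋
    ρi%2≡0 : ρ i % 2 ≡ 0
    ρi%2≡0 = trans (cong (_% 2) ρi≡) ρi-even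
    h≡ : h ≡ suc ⌊ ρ′ i /2⌋
    h≡ = trans (cong ⌊_/2⌋ ρi≡) half≡
    odd≡ : odd ρ′ ≡ suc (odd ρ)
    odd≡ = Σℕ.sum-step _ _ i 1 (λ j j≢i → cong (_% 2) (sym (agree j j≢i))) (trans ρ′i-odd (cong suc (sym ρi%2≡0)))
    halfSum≡ : half ρ ≡ suc (half ρ′)
    halfSum≡ = Σℕ.sum-step _ _ i 1 (λ j j≢i → cong ⌊_/2⌋ (agree j j≢i)) h≡
    halfFact≡ : halfFact ρ ≡ h * halfFact ρ′
    halfFact≡ = Πℕ.sum-step _ _ i h (λ j j≢i → cong (λ r → ⌊ r /2⌋ !) (agree j j≢i))
                  (trans (cong _! h≡) (cong (_* (⌊ ρ′ i /2⌋ !)) (sym h≡)))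

  -- Assembling the contributions: with o odd entries and half-total H,
  -- o * oddPart + Y * evenPart is the closed form, where Y is the (then
  -- unsigned) number of halves when o = 0.
  assemble : ∀ o H (Y : ℤ) → (o ≡ 0 → Y ≡ + H × H ≢ 0) →
    + (o % 2) ℤ* (χ (pred o) ℤ* + (H !)) ℤ+ Y ℤ* (χ (suc o) ℤ* + (pred H !)) ≡ χ o ℤ* + (H !)
  assemble zero H Y no-odd with no-odd refl
  ... | Y≡H , H≢0 = begin
    + 0 ℤ* (+ 1 ℤ* + (H !)) ℤ+ Y ℤ* (+ 1 ℤ* + (pred H !))
                                                    ≡⟨ ℤP.+-identityˡ _ ⟩
    Y ℤ* (+ 1 ℤ* + (pred H !))                      ≡⟨ cong₂ _ℤ*_ Y≡H (ℤP.*-identityˡ _) ⟩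
    + H ℤ* + (pred H !)                             ≡⟨ ℤP.pos-* H (pred H !) ⟨
    + (H * pred H !)                                ≡⟨ cong +_ (H*[H-1]!≡H! H H≢0) ⟩
    + (H !)                                         ≡⟨ ℤP.*-identityˡ _ ⟨
    + 1 ℤ* + (H !)                                  ∎
    where
    open ≡-Reasoning
    H*[H-1]!≡H! : ∀ H → H ≢ 0 → H * pred H ! ≡ H !
    H*[H-1]!≡H! zero    H≢0 = contradiction refl H≢0
    H*[H-1]!≡H! (suc H) _   = refl
  assemble (suc q) H Y _ =
    trans (cong (+ (suc q % 2) ℤ* (χ q ℤ* + (H !)) ℤ+_) (ℤP.*-zeroʳ Y)) (trans (ℤP.+-identityʳ _) (χ-step q))
    where
    χ-step : ∀ q → + (suc q % 2) ℤ* (χ q ℤ* + (H !)) ≡ χ (suc q) ℤ* + (H !)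
    χ-step zero          = ℤP.*-identityˡ _
    χ-step (suc zero)    = refl
    χ-step (suc (suc q)) = ℤP.*-zeroʳ (+ (suc (suc (suc q)) % 2))

  ∑ℤ-pos : ∀ {k} (f : Fin k → ℕ) → Σℤ.∑ (λ i → + f i) ≡ + Σℕ.∑ f
  ∑ℤ-pos {zero}  f = refl
  ∑ℤ-pos {suc k} f = trans (cong (+ f zero ℤ+_) (∑ℤ-pos (f ∘ suc))) (sym (ℤP.pos-+ (f zero) _))

  half≢0 : ∀ {k} (ρ : Fin k → ℕ) → Σℕ.∑ ρ ≢ 0 → odd ρ ≡ 0 → half ρ ≢ 0
  half≢0 ρ ρ≢0 odd≡0 half≡0 = ρ≢0 (Σℕ.∑-vanish ρ (λ i →
    even-no-half⇒0 (ρ i) (∑ℕ≡0 (λ i → ρ i % 2) odd≡0 i) (∑ℕ≡0 (λ i → ⌊ ρ i /2⌋) half≡0 i)))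

  closed-form-step : ∀ {k} (ρ : Fin k → ℕ) → Σℕ.∑ ρ ≢ 0 →
                     Σℤ.∑ (λ i → sgn (prefix ρ (toℕ i)) ℤ* contribution ρ i) ≡ target ρ
  closed-form-step ρ ρ≢0 = begin
    Σℤ.∑ (λ i → s i ℤ* contribution ρ i)
      ≡⟨ Σℤ.sum-cong-≗ (λ i → expand (s i) (x i) (y i) (oddPart ρ) (evenPart ρ)) ⟩
    Σℤ.∑ (λ i → x i ℤ* s i ℤ* oddPart ρ ℤ+ y i ℤ* s i ℤ* evenPart ρ)
      ≡⟨ ∑-distrib-+ (λ i → x i ℤ* s i ℤ* oddPart ρ) (λ i → y i ℤ* s i ℤ* evenPart ρ) ⟩
    Σℤ.∑ (λ i → x i ℤ* s i ℤ* oddPart ρ) ℤ+ Σℤ.∑ (λ i → y i ℤ* s i ℤ* evenPart ρ)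
      ≡⟨ cong₂ _ℤ+_ (*-distribʳ-sum (oddPart ρ) (λ i → x i ℤ* s i)) (*-distribʳ-sum (evenPart ρ) (λ i → y i ℤ* s i)) ⟨
    Σℤ.∑ (λ i → x i ℤ* s i) ℤ* oddPart ρ ℤ+ Σℤ.∑ (λ i → y i ℤ* s i) ℤ* evenPart ρ
      ≡⟨ cong (λ v → v ℤ* oddPart ρ ℤ+ Σℤ.∑ (λ i → y i ℤ* s i) ℤ* evenPart ρ) (sgn-prefix-odd ρ) ⟩
    + (odd ρ % 2) ℤ* oddPart ρ ℤ+ Σℤ.∑ (λ i → y i ℤ* s i) ℤ* evenPart ρ
      ≡⟨ assemble (odd ρ) (half ρ) (Σℤ.∑ (λ i → y i ℤ* s i)) (λ odd≡0 → unsigned odd≡0 , half≢0 ρ ρ≢0 odd≡0) ⟩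
    target ρ
      ∎
    where
    open ≡-Reasoning
    s x y : Fin _ → ℤ
    s i = sgn (prefix ρ (toℕ i))
    x i = + (ρ i % 2)
    y i = + ⌊ ρ i /2⌋
    expand : ∀ s x y A B → s ℤ* (x ℤ* A ℤ+ y ℤ* B) ≡ x ℤ* s ℤ* A ℤ+ y ℤ* s ℤ* B
    expand = solve 5 (λ s x y A B → s :* (x :* A :+ y :* B) := x :* s :* A :+ y :* s :* B) refl
    unsigned : odd ρ ≡ 0 → Σℤ.∑ (λ i → y i ℤ* s i) ≡ + half ρ
    unsigned odd≡0 = trans
      (Σℤ.sum-cong-≗ (λ i → trans (cong (y i ℤ*_) (sgn-prefix-even ρ odd≡0 (toℕ i))) (ℤP.*-identityʳ (y i))))
      (∑ℤ-pos (λ i → ⌊ ρ i /2⌋))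

  χ-≤1 : ∀ {o} → o ≤ 1 → χ o ≡ + 1
  χ-≤1 z≤n       = refl
  χ-≤1 (s≤s z≤n) = refl

  χ-≥2 : ∀ {o} → o ≥ 2 → χ o ≡ + 0
  χ-≥2 (s≤s (s≤s _)) = refl

module SignedCount (m0 : ℕ) (m : Fin m0 → ℕ) where
  open Antichain m0 m
  open Signs m0 m
  open SignedMultinomial
  open Comparisons
  open import Algebra.Properties.Semiring.Sum ℤP.+-*-semiring using (*-distribʳ-sum)

  signed-closed-form : ∀ n a → size a ≡ n → signed n a ℤ* + halfFact (rem a) ≡ target (rem a)
  signed-closed-form zero a size≡0 =
    trans (cong (λ p → + 1 ℤ* + p) halfFact≡1) (cong₂ (λ o h → χ o ℤ* + (h !)) (sym odd≡0) (sym half≡0))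
    where
    exhausted : ∀ i → rem a i ≡ 0
    exhausted = rem-exhausted a size≡0
    halfFact≡1 : halfFact (rem a) ≡ 1
    halfFact≡1 = Πℕ.∑-vanish _ (λ i → cong (λ r → ⌊ r /2⌋ !) (exhausted i))
    odd≡0 : odd (rem a) ≡ 0
    odd≡0 = Σℕ.∑-vanish _ (λ i → cong (_% 2) (exhausted i))
    half≡0 : half (rem a) ≡ 0
    half≡0 = Σℕ.∑-vanish _ (λ i → cong ⌊_/2⌋ (exhausted i))
  signed-closed-form (suc n) a size≡ = begin
    signed (suc n) a ℤ* + P                   ≡⟨ cong (_ℤ* + P) (signed-step n a size≡) ⟩
    Σℤ.∑ c ℤ* + P                             ≡⟨ *-distribʳ-sum (+ P) c ⟩
    Σℤ.∑ (λ i → c i ℤ* + P)                   ≡⟨ Σℤ.sum-cong-≗ term ⟩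
    Σℤ.∑ (λ i → s i ℤ* contribution (rem a) i) ≡⟨ closed-form-step (rem a) (λ size≡0 → ℕP.1+n≢0 (trans (sym size≡) size≡0)) ⟩
    target (rem a)                            ∎
    where
    open ≡-Reasoning
    P : ℕ
    P = halfFact (rem a)
    s c : Fin m0 → ℤ
    s i = sgn (prefix (rem a) (toℕ i))
    c i = if a i <ᵇ m i then s i ℤ* signed n (next a i) else + 0
    term : ∀ i → c i ℤ* + P ≡ s i ℤ* contribution (rem a) i
    term i with a i <? m i
    ... | yes ai<mi rewrite <ᵇ-true ai<mi = trans (ℤP.*-assoc (s i) _ (+ P))
      (cong (s i ℤ*_) (contribution-lower (rem a) (rem (next a i)) i (λ _ → rem-set a i _) (rem-next a i ai<mi)
        (signed n (next a i)) (signed-closed-form n (next a i) (size-next-pred a i ai<mi size≡))))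
    ... | no ai≮mi rewrite <ᵇ-false ai≮mi = sym (trans
      (cong (λ r → s i ℤ* (+ (r % 2) ℤ* oddPart (rem a) ℤ+ + ⌊ r /2⌋ ℤ* evenPart (rem a)))
            (ℕP.m≤n⇒m∸n≡0 (ℕP.≮⇒≥ ai≮mi)))
      (ℤP.*-zeroʳ (s i)))

module Initial (m0 : ℕ) (m : Fin m0 → ℕ) where
  open Antichain m0 m
  open Counting m0 m public using (count-multinomial)
  open Signs m0 m using (signSum; signed)
  open SignedCount m0 m using (signed-closed-form)
  open SignedMultinomial using (odd; half; halfFact)
  open SignedMultinomial public using (χ; χ-≤1; χ-≥2)

  start : State
  start _ = 0

  -- Every letter is admissible at the start.
  linearizations-start : linearizations m0 (antichain m0) m ≡ Lin (total m0 m) (avail start)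
  linearizations-start = BoolLists.filterB-All-cong
    (All.universal (λ w → cong (_∧ (distinct w ∧ refines (starLeq (antichain m0)) w)) (sym (all-avail w)))
                   (words (total m0 m) (elems m0 m)))
    where
    all-avail : ∀ w → allB (avail start) w ≡ true
    all-avail []      = refl
    all-avail (_ ∷ w) = all-avail w

  size-start : size start ≡ total m0 m
  size-start = sym (Σℕ.foldr-tabulate m (λ i → i))

  odd-start : oddCount m0 m ≡ odd (rem start)
  odd-start = count-odd (λ i → i)
    where
    count-odd : ∀ {k} (g : Fin k → Fin m0) →
                length (filterB (λ i → m i % 2 ≡ᵇ 1) (tabulate g)) ≡ Σℕ.∑ (λ i → m (g i) % 2)
    count-odd {zero}  g = refl
    count-odd {suc k} g with parityStep (m (g zero))
    ... | from-even even _ _ rewrite even = count-odd (g ∘ suc)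
    ... | from-odd  odd  _ _ rewrite odd  = cong suc (count-odd (g ∘ suc))

  halfFact-start : product (map (λ i → ⌊ m i /2⌋ !) (allFin m0)) ≡ halfFact (rem start)
  halfFact-start = Πℕ.foldr-tabulate (λ i → ⌊ m i /2⌋ !) (λ i → i)

  signed-start : Lminus m0 (antichain m0) m ℤ* + product (map (λ i → ⌊ m i /2⌋ !) (allFin m0))
                 ≡ χ (oddCount m0 m) ℤ* + (sum (map (λ i → ⌊ m i /2⌋) (allFin m0)) !)
  signed-start = begin
    Lminus m0 (antichain m0) m ℤ* + product (map (λ i → ⌊ m i /2⌋ !) (allFin m0))
      ≡⟨ cong₂ (λ L p → signSum L ℤ* + p) linearizations-start halfFact-start ⟩
    signed (total m0 m) start ℤ* + halfFact (rem start)
      ≡⟨ signed-closed-form (total m0 m) start size-start ⟩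
    χ (odd (rem start)) ℤ* + (half (rem start) !)
      ≡⟨ cong₂ (λ o h → χ o ℤ* + (h !)) (sym odd-start) (sym (Σℕ.foldr-tabulate (λ i → ⌊ m i /2⌋) (λ i → i))) ⟩
    χ (oddCount m0 m) ℤ* + (sum (map (λ i → ⌊ m i /2⌋) (allFin m0)) !)
      ∎
    where open ≡-Reasoning

proposition4p5 : (m0 : ℕ) (m : Fin m0 → ℕ) →
    (Lplus m0 (antichain m0) m * product (map (λ i → m i !) (allFin m0))
       ≡ sum (map m (allFin m0)) !)
    × (oddCount m0 m ≤ 1 →
       Lminus m0 (antichain m0) m
         ℤ* + product (map (λ i → ⌊ m i /2⌋ !) (allFin m0))
         ≡ + (sum (map (λ i → ⌊ m i /2⌋) (allFin m0)) !))
    × (oddCount m0 m ≥ 2 → Lminus m0 (antichain m0) m ≡ + 0)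
proposition4p5 m0 m = multinomial , at-most-one-odd , several-odd
  where
  open Initial m0 m
  L₋ : ℤ
  L₋ = Lminus m0 (antichain m0) m
  H P : ℕ
  H = sum (map (λ i → ⌊ m i /2⌋) (allFin m0))
  P = product (map (λ i → ⌊ m i /2⌋ !) (allFin m0))

  multinomial : Lplus m0 (antichain m0) m * product (map (λ i → m i !) (allFin m0)) ≡ total m0 m !
  multinomial = trans
    (cong₂ _*_ (cong length linearizations-start) (Πℕ.foldr-tabulate (λ i → m i !) (λ i → i)))
    (count-multinomial (total m0 m) start size-start)

  at-most-one-odd : oddCount m0 m ≤ 1 → L₋ ℤ* + P ≡ + (H !)
  at-most-one-odd odd≤1 =
    trans signed-start (trans (cong (_ℤ* + (H !)) (χ-≤1 odd≤1)) (ℤP.*-identityˡ (+ (H !))))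

  several-odd : oddCount m0 m ≥ 2 → L₋ ≡ + 0
  several-odd odd≥2 =
    ℤP.*-cancelʳ-≡ L₋ (+ 0) (+ P) {{P≢0}} (trans signed-start (cong (_ℤ* + (H !)) (χ-≥2 odd≥2)))
    where
    P≢0 : NonZero P
    P≢0 = subst NonZero (sym halfFact-start) (∏!-nonZero (λ i → ⌊ m i /2⌋))
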